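{- For every $n\in\mathbb{N}$, there is a complete generalized Zeckendorf game on $n$ in which every move is a combining move.
   Context: Let $a_1=1$, $a_2=2$ and $a_{i+1}=i\,a_i+a_{i-1}$ for $i\ge 2$. The generalized Zeckendorf game on $n$: the state is a multiset of terms of the sequence, initially $n$ copies of $a_1=1$. A move is one of: (combining) replace two $1$'s by one $2$; or, for $i\ge 2$, if the multiset contains at least $i$ copies of $a_i$ and at least one $a_{i-1}$, replace $i$ copies of $a_i$ and one $a_{i-1}$ by one $a_{i+1}$; (splitting) if it contains three $2$'s, replace them by one $1$ and one $5$; or, for $i\ge 3$, if it contains $i+1$ copies of $a_i$, replace them by one $a_{i+1}$, $i-2$ copies of $a_{i-1}$ and one $a_{i-2}$. The game ends when no move is available. A complete game is a sequence of legal moves from the initial state to a state with no available move. -}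

module Defs where

open import Data.Nat using (ℕ; zero; suc; _+_; _*_; _∸_; _≤_; _≡ᵇ_)
open import Data.Bool using (if_then_else_)
open import Data.Empty using (⊥)
open import Data.Unit using (⊤)
open import Data.Product using (_×_)
open import Data.List using (List; []; _∷_)
open import Relation.Nullary using (¬_)

-- The sequence a_1 = 1, a_2 = 2, a_{i+1} = i a_i + a_{i-1}  (a 0 is a dummy value).
a : ℕ → ℕ
a zero = 0
a (suc zero) = 1
a (suc (suc zero)) = 2
a (suc (suc (suc k))) = suc (suc k) * a (suc (suc k)) + a (suc k)

-- A game state is a multiset of terms of the sequence, represented by
-- multiplicities:  s i  =  number of copies of a_i  (i ≥ 1; s 0 is unused).
State : Set
State = ℕ → ℕ

add : ℕ → ℕ → State → State
add k d s j = if j ≡ᵇ k then s j + d else s j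

remove : ℕ → ℕ → State → State
remove k d s j = if j ≡ᵇ k then s j ∸ d else s j

initial : ℕ → State
initial n j = if j ≡ᵇ 1 then n else 0

-- Moves.  combine i (i ≥ 1):  i = 1: two a_1 ↦ one a_2;
--                            i ≥ 2: i copies of a_i and one a_{i-1} ↦ one a_{i+1}.
--         split i (i ≥ 2):    i = 2: three a_2 ↦ one a_1 and one a_3 (= 5);
--                            i ≥ 3: i+1 copies of a_i ↦ one a_{i+1}, i-2 copies of a_{i-1}, one a_{i-2}.
data Move : Set where
  combine : ℕ → Move
  split   : ℕ → Move

Legal : Move → State → Set
Legal (combine zero) s = ⊥
Legal (combine (suc zero)) s = 2 ≤ s 1
Legal (combine (suc (suc k))) s = suc (suc k) ≤ s (suc (suc k)) × 1 ≤ s (suc k)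
Legal (split zero) s = ⊥
Legal (split (suc zero)) s = ⊥
Legal (split (suc (suc zero))) s = 3 ≤ s 2
Legal (split (suc (suc (suc k)))) s = suc (suc (suc (suc k))) ≤ s (suc (suc (suc k)))

-- effect of a move (only meaningful when legal)
apply : Move → State → State
apply (combine zero) s = s
apply (combine (suc zero)) s = add 2 1 (remove 1 2 s)
apply (combine (suc (suc k))) s =
  add (suc (suc (suc k))) 1 (remove (suc k) 1 (remove (suc (suc k)) (suc (suc k)) s))
apply (split zero) s = s
apply (split (suc zero)) s = s
apply (split (suc (suc zero))) s = add 3 1 (add 1 1 (remove 2 3 s))
apply (split (suc (suc (suc k)))) s =
  add (suc k) 1 (add (suc (suc k)) (suc k)
    (add (suc (suc (suc (suc k)))) 1 (remove (suc (suc (suc k))) (suc (suc (suc (suc k)))) s)))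

Terminal : State → Set
Terminal s = ∀ m → ¬ Legal m s

data CompleteGame : State → List Move → Set where
  done : ∀ {s} → Terminal s → CompleteGame s []
  step : ∀ {s m ms} → Legal m s → CompleteGame (apply m s) ms → CompleteGame s (m ∷ ms)

IsCombining : Move → Set
IsCombining (combine _) = ⊤
IsCombining (split _) = ⊥

-- Always play the greatest legal combining move.  Throughout, every a_j with
-- j ≥ 2 occurs at most j times, which rules out every splitting move.  If the
-- greatest legal move is the combine creating a_{m+2}, then a_{m+1} is present
-- while the combine creating a_{m+3} is illegal, so fewer than m + 2 copies of
-- a_{m+2} are present and the bound survives the move.  Every combining move
-- lowers the number of pieces, so the game ends.
module Submission where

open import Defs
open import Data.Nat using (ℕ)
open import Data.Product using (∃; _×_)
open import Data.List.Relation.Unary.All using (All)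

open import Level using (Level)
open import Data.Nat using (zero; suc; _+_; _∸_; _≤_; _<_; _≡ᵇ_; z≤n; s≤s; _≤?_; _<?_)
open import Data.Nat.Properties
open import Algebra.Properties.CommutativeSemigroup +-commutativeSemigroup using (xy∙z≈xz∙y)
open import Data.Bool using (true; false; if_then_else_)
open import Data.Product using (_,_)
open import Data.Sum using (_⊎_; inj₁; inj₂; [_,_])
open import Data.List using ([]; _∷_)
open import Data.List.Relation.Unary.All using ([]; _∷_)
open import Data.Unit using (tt)
open import Relation.Nullary using (¬_; yes; no; contradiction)
open import Relation.Nullary.Decidable using (_×-dec_)
open import Relation.Unary using (Pred; Decidable)
open import Relation.Binary.PropositionalEquality hiding ([_])

module _ {ℓ : Level} {P : Pred ℕ ℓ} (P? : Decidable P) where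

  greatestBelow : ∀ B → (∀ n → n < B → ¬ P n)
                      ⊎ ∃ λ m → m < B × P m × (∀ n → m < n → n < B → ¬ P n)
  greatestBelow zero = inj₁ (λ _ ())
  greatestBelow (suc B) with P? B
  ... | yes pB = inj₂ (B , n<1+n B , pB , λ n B<n n<1+B → contradiction B<n (≤⇒≯ (≤-pred n<1+B)))
  ... | no ¬pB with greatestBelow B
  ...   | inj₁ none = inj₁ λ n n<1+B →
          [ none n , (λ { refl → ¬pB }) ] (m<1+n⇒m<n∨m≡n n<1+B)
  ...   | inj₂ (m , m<B , pm , above) = inj₂ (m , m<n⇒m<1+n m<B , pm , λ n m<n n<1+B →
          [ above n m<n , (λ { refl → ¬pB }) ] (m<1+n⇒m<n∨m≡n n<1+B))

if-≡ᵇ-refl : ∀ {A : Set} k {x y : A} → (if k ≡ᵇ k then x else y) ≡ x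
if-≡ᵇ-refl k with k ≡ᵇ k | ≡⇒≡ᵇ k k refl
... | true  | _  = refl
... | false | ()

if-≡ᵇ-≢ : ∀ {A : Set} {j k} {x y : A} → j ≢ k → (if j ≡ᵇ k then x else y) ≡ y
if-≡ᵇ-≢ {j = j} {k} j≢k with j ≡ᵇ k | ≡ᵇ⇒≡ j k
... | false | _   = refl
... | true  | j≡k = contradiction (j≡k tt) j≢k

add-≡ : ∀ k d s → add k d s k ≡ s k + d
add-≡ k d s = if-≡ᵇ-refl k

add-≢ : ∀ k d s {j} → j ≢ k → add k d s j ≡ s j
add-≢ k d s = if-≡ᵇ-≢

remove-≡ : ∀ k d s → remove k d s k ≡ s k ∸ d
remove-≡ k d s = if-≡ᵇ-refl k

remove-≢ : ∀ k d s {j} → j ≢ k → remove k d s j ≡ s j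
remove-≢ k d s = if-≡ᵇ-≢

remove-≤ : ∀ k d s j → remove k d s j ≤ s j
remove-≤ k d s j with j ≟ k
... | yes refl = ≤-trans (≤-reflexive (remove-≡ k d s)) (m∸n≤m (s k) d)
... | no j≢k   = ≤-reflexive (remove-≢ k d s j≢k)

add-remove : ∀ k d s → d ≤ s k → ∀ j → add k d (remove k d s) j ≡ s j
add-remove k d s d≤sk j with j ≟ k
... | yes refl = begin
  add k d (remove k d s) k  ≡⟨ add-≡ k d (remove k d s) ⟩
  remove k d s k + d        ≡⟨ cong (_+ d) (remove-≡ k d s) ⟩
  s k ∸ d + d               ≡⟨ m∸n+n≡m d≤sk ⟩
  s k                       ∎
  where open ≡-Reasoning
... | no j≢k = trans (add-≢ k d (remove k d s) j≢k) (remove-≢ k d s j≢k)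

pieces : ℕ → State → ℕ
pieces zero    s = 0
pieces (suc C) s = s (suc C) + pieces C s

pieces-cong : ∀ C {t u : State} → (∀ j → t j ≡ u j) → pieces C t ≡ pieces C u
pieces-cong zero    t≗u = refl
pieces-cong (suc C) t≗u = cong₂ _+_ (t≗u (suc C)) (pieces-cong C t≗u)

pieces-add-beyond : ∀ C {k} d t → C < k → pieces C (add k d t) ≡ pieces C t
pieces-add-beyond zero    d t C<k = refl
pieces-add-beyond (suc C) {k} d t C<k =
  cong₂ _+_ (add-≢ k d t (<⇒≢ C<k)) (pieces-add-beyond C d t (<-trans (n<1+n C) C<k))

pieces-add : ∀ C {k} d t → 1 ≤ k → k ≤ C → pieces C (add k d t) ≡ pieces C t + d
pieces-add zero    d t 1≤k k≤0 = contradiction (≤-trans 1≤k k≤0) λ ()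
pieces-add (suc C) {k} d t 1≤k k≤1+C with suc C ≟ k
... | yes refl = begin
  add k d t k + pieces C (add k d t)
    ≡⟨ cong₂ _+_ (add-≡ k d t) (pieces-add-beyond C d t (n<1+n C)) ⟩
  t k + d + pieces C t            ≡⟨ xy∙z≈xz∙y (t k) d (pieces C t) ⟩
  t k + pieces C t + d            ∎
  where open ≡-Reasoning
... | no 1+C≢k = begin
  add k d t (suc C) + pieces C (add k d t)
    ≡⟨ cong₂ _+_ (add-≢ k d t 1+C≢k) (pieces-add C d t 1≤k (≤-pred (≤∧≢⇒< k≤1+C (≢-sym 1+C≢k)))) ⟩
  t (suc C) + (pieces C t + d)
    ≡⟨ +-assoc (t (suc C)) (pieces C t) d ⟨
  t (suc C) + pieces C t + d      ∎
  where open ≡-Reasoning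

pieces-remove : ∀ C {k} d t → 1 ≤ k → k ≤ C → d ≤ t k → pieces C (remove k d t) + d ≡ pieces C t
pieces-remove C {k} d t 1≤k k≤C d≤tk =
  trans (sym (pieces-add C d (remove k d t) 1≤k k≤C)) (pieces-cong C (add-remove k d t d≤tk))

-- Indices are shifted by one: combining move number m + 1 creates a_{m+2}.
Combinable : ℕ → State → Set
Combinable m s = Legal (combine (suc m)) s

combinable? : ∀ s → Decidable (λ m → Combinable m s)
combinable? s zero    = 2 ≤? s 1
combinable? s (suc m) = (2 + m ≤? s (2 + m)) ×-dec (1 ≤? s (1 + m))

combinable⇒occupied : ∀ {m s} → Combinable m s → 1 ≤ s (suc m)
combinable⇒occupied {zero}  two≤s1     = ≤-trans (s≤s z≤n) two≤s1
combinable⇒occupied {suc m} (many , _) = ≤-trans (s≤s z≤n) many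

combine-target : ∀ m s → apply (combine (suc m)) s (2 + m) ≡ s (2 + m) + 1
combine-target zero s =
  trans (add-≡ 2 1 (remove 1 2 s)) (cong (_+ 1) (remove-≢ 1 2 s λ ()))
combine-target (suc m) s =
  trans (add-≡ (3 + m) 1 r₂)
    (cong (_+ 1) (trans (remove-≢ (1 + m) 1 r₁ 3+m≢1+m) (remove-≢ (2 + m) (2 + m) s 3+m≢2+m)))
  where
  r₁ r₂ : State
  r₁ = remove (2 + m) (2 + m) s
  r₂ = remove (1 + m) 1 r₁
  3+m≢2+m : 3 + m ≢ 2 + m
  3+m≢2+m = >⇒≢ (n<1+n (2 + m))
  3+m≢1+m : 3 + m ≢ 1 + m
  3+m≢1+m = >⇒≢ (m<n⇒m<1+n (n<1+n (1 + m)))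

combine-elsewhere : ∀ m s {j} → j ≢ 2 + m → apply (combine (suc m)) s j ≤ s j
combine-elsewhere zero s {j} j≢2 =
  ≤-trans (≤-reflexive (add-≢ 2 1 (remove 1 2 s) j≢2)) (remove-≤ 1 2 s j)
combine-elsewhere (suc m) s {j} j≢3+m =
  ≤-trans (≤-reflexive (add-≢ (3 + m) 1 r₂ j≢3+m))
    (≤-trans (remove-≤ (1 + m) 1 r₁ j) (remove-≤ (2 + m) (2 + m) s j))
  where
  r₁ r₂ : State
  r₁ = remove (2 + m) (2 + m) s
  r₂ = remove (1 + m) 1 r₁

pieces-combine : ∀ {C m s} → Combinable m s → 2 + m ≤ C →
                 pieces C (apply (combine (suc m)) s) < pieces C s
pieces-combine {C} {zero} {s} two≤s1 2≤C = begin-strict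
  pieces C (add 2 1 r)   ≡⟨ pieces-add C 1 r (s≤s z≤n) 2≤C ⟩
  pieces C r + 1         <⟨ +-monoʳ-< (pieces C r) (n<1+n 1) ⟩
  pieces C r + 2         ≡⟨ pieces-remove C 2 s ≤-refl (≤-trans (n≤1+n 1) 2≤C) two≤s1 ⟩
  pieces C s             ∎
  where
  open ≤-Reasoning
  r : State
  r = remove 1 2 s
pieces-combine {C} {suc m} {s} (many , present) 3+m≤C = begin-strict
  pieces C (add (3 + m) 1 r₂)  ≡⟨ pieces-add C 1 r₂ (s≤s z≤n) 3+m≤C ⟩
  pieces C r₂ + 1              ≡⟨ pieces-remove C 1 r₁ (s≤s z≤n) 1+m≤C present′ ⟩
  pieces C r₁                  <⟨ m<m+n (pieces C r₁) (s≤s z≤n) ⟩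
  pieces C r₁ + (2 + m)        ≡⟨ pieces-remove C (2 + m) s (s≤s z≤n) (≤-trans (n≤1+n _) 3+m≤C) many ⟩
  pieces C s                   ∎
  where
  open ≤-Reasoning
  r₁ r₂ : State
  r₁ = remove (2 + m) (2 + m) s
  r₂ = remove (1 + m) 1 r₁
  1+m≤C : 1 + m ≤ C
  1+m≤C = ≤-trans (m≤n⇒m≤1+n (n≤1+n _)) 3+m≤C
  present′ : 1 ≤ r₁ (1 + m)
  present′ = subst (1 ≤_) (sym (remove-≢ (2 + m) (2 + m) s (<⇒≢ (n<1+n (1 + m))))) present

Capped : State → Set
Capped s = ∀ j → 2 ≤ j → s j ≤ j

Supported : ℕ → State → Set
Supported B s = ∀ j → B < j → s j ≡ 0

capped⇒¬split : ∀ {s} → Capped s → ∀ i → ¬ Legal (split i) s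
capped⇒¬split c (suc (suc zero)) three≤s2 =
  contradiction (≤-trans three≤s2 (c 2 ≤-refl)) λ { (s≤s (s≤s ())) }
capped⇒¬split c (suc (suc (suc i))) many =
  contradiction (≤-trans many (c (3 + i) (s≤s (s≤s z≤n)))) 1+n≰n

terminal : ∀ {s} → Capped s → (∀ m → ¬ Combinable m s) → Terminal s
terminal c none (combine zero)    ()
terminal c none (combine (suc m)) = none m
terminal c none (split i)         = capped⇒¬split c i

combinable⇒< : ∀ {B s m} → Supported B s → Combinable m s → m < B
combinable⇒< {B} {s} {m} S can with m <? B
... | yes m<B = m<B
... | no m≮B  = contradiction (subst (1 ≤_) (S (suc m) (s≤s (≮⇒≥ m≮B))) (combinable⇒occupied can)) λ ()

greatest-combine-room : ∀ {m s} → Combinable m s → ¬ Combinable (suc m) s → s (2 + m) < 2 + m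
greatest-combine-room {m} {s} can ¬next with 2 + m ≤? s (2 + m)
... | yes many = contradiction (many , combinable⇒occupied can) ¬next
... | no few   = ≰⇒> few

combine-keeps-capped : ∀ {m s} → Capped s → Combinable m s → ¬ Combinable (suc m) s →
                       Capped (apply (combine (suc m)) s)
combine-keeps-capped {m} {s} c can ¬next j 2≤j with j ≟ 2 + m
... | yes refl = begin
  apply (combine (suc m)) s (2 + m)  ≡⟨ combine-target m s ⟩
  s (2 + m) + 1                      ≡⟨ +-comm (s (2 + m)) 1 ⟩
  suc (s (2 + m))                    ≤⟨ greatest-combine-room can ¬next ⟩
  2 + m                              ∎
  where open ≤-Reasoning
... | no j≢2+m = ≤-trans (combine-elsewhere m s j≢2+m) (c j 2≤j)

combine-keeps-supported : ∀ {B m s} → Supported B s → m < B →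
                          Supported (suc B) (apply (combine (suc m)) s)
combine-keeps-supported {B} {m} {s} S m<B j 1+B<j =
  n≤0⇒n≡0 (≤-trans (combine-elsewhere m s j≢2+m) (≤-reflexive (S j (<-trans (n<1+n B) 1+B<j))))
  where
  j≢2+m : j ≢ 2 + m
  j≢2+m = >⇒≢ (≤-<-trans (s≤s m<B) 1+B<j)

pieces-decrease : ∀ {B m s} → Supported B s → Combinable m s → m < B →
                  pieces (suc B) (apply (combine (suc m)) s) < pieces B s
pieces-decrease {B} {m} {s} S can m<B =
  subst (pieces (suc B) (apply (combine (suc m)) s) <_)
    (cong (_+ pieces B s) (S (suc B) (n<1+n B))) (pieces-combine can (s≤s m<B))

combining-game : ∀ p B s → Capped s → Supported B s → pieces B s ≤ p →
                 ∃ λ ms → CompleteGame s ms × All IsCombining ms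
combining-game p B s c S bound with greatestBelow (combinable? s) B
... | inj₁ none = [] , done (terminal c λ m can → none m (combinable⇒< S can) can) , []
combining-game zero B s c S bound | inj₂ (m , m<B , can , _) =
  contradiction (≤-trans (pieces-decrease S can m<B) bound) λ ()
combining-game (suc p) B s c S bound | inj₂ (m , m<B , can , greatest)
  with combining-game p (suc B) (apply (combine (suc m)) s)
         (combine-keeps-capped c can ¬next) (combine-keeps-supported S m<B)
         (≤-pred (≤-trans (pieces-decrease S can m<B) bound))
  where
  ¬next : ¬ Combinable (suc m) s
  ¬next can′ = greatest (suc m) (n<1+n m) (combinable⇒< S can′) can′
... | ms , game , combining = combine (suc m) ∷ ms , step can game , tt ∷ combining

initial-capped : ∀ n → Capped (initial n)
initial-capped n j 2≤j = ≤-trans (≤-reflexive (if-≡ᵇ-≢ (>⇒≢ 2≤j))) z≤n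

initial-supported : ∀ n → Supported 1 (initial n)
initial-supported n j 1<j = if-≡ᵇ-≢ (>⇒≢ 1<j)

lemma6p4 : (n : ℕ) → ∃ λ ms → CompleteGame (initial n) ms × All IsCombining ms
lemma6p4 n = combining-game n 1 (initial n) (initial-capped n) (initial-supported n)
               (≤-reflexive (+-identityʳ n))
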